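{- Let $q\ge3$, let $\mathbf f\in A_q^+\setminus W_q$ have last symbol $q-1$, and let $\mathbf p\in A_q^*(\mathbf f)$. If $\mathbf a$ is the first or the last word of $\mathbf p|A_q^\infty(\mathbf f)$ with respect to the appropriate order, then $\mathbf a=\mathbf p\mathbf r0^\infty$ where $\mathbf r$ is one of $\epsilon$, $(q-1)$, $(q-2)(q-1)$.
   Context: $A_q=\{0,1,\dots,q-1\}$. $A_q^*$ (resp. $A_q^+$) is the set of all (resp. nonempty) finite words, $\epsilon$ the empty word, $A_q^\infty$ the right-infinite words; $0^\infty=000\cdots$. For a set $X$ of words, $X(\mathbf f)$ is the set of words of $X$ not containing $\mathbf f$ as a factor (contiguous subword), $\mathbf p|X$ the words of $X$ with prefix $\mathbf p$. For distinct words $\mathbf s,\mathbf t$ of the same (finite or infinite) length, with $k$ the leftmost differing position, $u=\sum_{i<k}s_i$, $v$ the number of nonzero symbols among $s_1,\dots,s_{k-1}$: $\mathbf s\prec\mathbf t$ iff ($u$ even and $s_k<t_k$) or ($u$ odd and $s_k>t_k$); $\mathbf s\triangleleft\mathbf t$ iff ($u+v$ even and $s_k<t_k$) or ($u+v$ odd and $s_k>t_k$). The appropriate order is $\prec$ for even $q$ and $\triangleleft$ for odd $q$; first/last mean least/greatest in it. $W_q=\{(q-2)^\ell(q-1):\ell\ge0\}$. -}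

module Defs where

open import Data.Nat using (ℕ; zero; suc; _+_; _∸_; _<_; _≤_)
open import Data.Nat.DivMod using (_%_)
open import Data.List using (List; []; _∷_; _++_; length; replicate; _∷ʳ_)
open import Data.List.Relation.Unary.All using (All)
open import Data.Product using (Σ; ∃; _×_; _,_)
open import Data.Sum using (_⊎_)
open import Relation.Binary.PropositionalEquality using (_≡_; _≢_)
open import Relation.Nullary using (¬_)

Word : ℕ → List ℕ → Set
Word q w = All (_< q) w

-- Infinite (right-infinite) words: sequences ℕ → ℕ (position 0 = first symbol).
Seq : Set
Seq = ℕ → ℕ

InfWord : ℕ → Seq → Set
InfWord q s = ∀ i → s i < q

infix 4 _≐_
_≐_ : Seq → Seq → Set
s ≐ t = ∀ i → s i ≡ t i

-- i-th symbol of a finite word (0-indexed), default 0 outside.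
at : List ℕ → ℕ → ℕ
at [] _ = 0
at (x ∷ w) zero = x
at (x ∷ w) (suc i) = at w i

FactorFin : List ℕ → List ℕ → Set
FactorFin f w = ∃ λ u → ∃ λ v → w ≡ u ++ (f ++ v)

FactorInf : List ℕ → Seq → Set
FactorInf f s = ∃ λ i → ∀ j → j < length f → s (i + j) ≡ at f j

PrefixOf : List ℕ → Seq → Set
PrefixOf p s = ∀ j → j < length p → s j ≡ at p j

InSet : ℕ → List ℕ → List ℕ → Seq → Set
InSet q f p s = InfWord q s × ¬ FactorInf f s × PrefixOf p s

infixr 5 _⊙_
_⊙_ : List ℕ → Seq → Seq
[] ⊙ s = s
(x ∷ w) ⊙ s = λ { zero → x ; (suc i) → (w ⊙ s) i }

zeros : Seq
zeros _ = 0

sumUpTo : Seq → ℕ → ℕ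
sumUpTo s zero = 0
sumUpTo s (suc k) = sumUpTo s k + s k

nzUpTo : Seq → ℕ → ℕ
nzUpTo s zero = 0
nzUpTo s (suc k) with s k
... | zero = nzUpTo s k
... | suc _ = suc (nzUpTo s k)

-- k is a differing position with agreement before (hence the leftmost),
-- and the comparison at k is decided by the parity of n.
Even : ℕ → Set
Even n = n % 2 ≡ 0

Odd : ℕ → Set
Odd n = n % 2 ≡ 1

cmpAt : ℕ → ℕ → ℕ → Set
cmpAt n a b = (Even n × a < b) ⊎ (Odd n × b < a)

_≺_ : Seq → Seq → Set
s ≺ t = ∃ λ k → (∀ i → i < k → s i ≡ t i) × cmpAt (sumUpTo s k) (s k) (t k)

_◁_ : Seq → Seq → Set
s ◁ t = ∃ λ k → (∀ i → i < k → s i ≡ t i) × cmpAt (sumUpTo s k + nzUpTo s k) (s k) (t k)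

Appr : ℕ → Seq → Seq → Set
Appr q s t = (Even q × s ≺ t) ⊎ (Odd q × s ◁ t)

IsFirst : ℕ → (Seq → Set) → Seq → Set
IsFirst q S a = S a × (∀ b → S b → b ≐ a ⊎ Appr q a b)

IsLast : ℕ → (Seq → Set) → Seq → Set
IsLast q S a = S a × (∀ b → S b → b ≐ a ⊎ Appr q b a)

InW : ℕ → List ℕ → Set
InW q f = ∃ λ ℓ → f ≡ replicate ℓ (q ∸ 2) ∷ʳ (q ∸ 1)

module Submission where

-- Both orders compare words at their first difference k by the parity of a
-- weight of the common prefix (symbol sum for ≺; plus the number of nonzero
-- symbols for ◁).  The weight is additive, and in the appropriate order q-1
-- has odd and q-2 even cost.  First we show that an extremal word a equals
-- every b in the set which a beats at no single position (extremal-unique).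
-- For a candidate p t only the tail t then matters, read in the orientation
-- σ given by the parity of p's weight and the direction (first or last):
-- for even σ the tail 0^∞ is unbeatable; for odd σ the tail (q-1)0^∞, or,
-- when g is a suffix of p (f = g(q-1)), the tail (q-2)(q-1)0^∞, since then
-- no word of the set has q-1 after p.  The candidates avoid f: an occurrence
-- must end in the tail at q-1, and in the last case it overlaps the suffix g
-- by one place, forcing g = (q-2)^ℓ and f ∈ W_q (self-overlap).

open import Defs
open import Data.Bool using (Bool; true; false)
open import Data.Nat using (ℕ; zero; suc; _+_; _∸_; _<_; _≤_; z≤n; s≤s; z<s; _≟_; _<?_; _≤?_; parity)
open import Data.Nat.Properties
open import Data.Nat.Tactic.RingSolver using (solve-∀)
open import Data.Parity.Base using (Parity; 0ℙ; 1ℙ; _⁻¹) renaming (_+_ to _⊕_)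
import Data.Parity.Properties as Parityₚ
open import Data.List using (List; []; _∷_; _∷ʳ_; _++_; length; replicate)
open import Data.List.Properties using (length-++)
open import Data.List.Relation.Unary.All using ([]; _∷_)
open import Data.Product using (∃; _×_; _,_; proj₁; proj₂)
open import Data.Sum using (_⊎_; inj₁; inj₂; [_,_]′)
open import Data.Empty using (⊥-elim)
open import Relation.Binary.PropositionalEquality
open import Relation.Nullary using (¬_; Dec; yes; no; contradiction)

even⇒parity : ∀ n → Even n → parity n ≡ 0ℙ
even⇒parity zero _ = refl
even⇒parity (suc zero) ()
even⇒parity (suc (suc n)) e = even⇒parity n e

odd⇒parity : ∀ n → Odd n → parity n ≡ 1ℙ
odd⇒parity zero ()
odd⇒parity (suc zero) _ = refl
odd⇒parity (suc (suc n)) o = odd⇒parity n o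

weight : Bool → Seq → ℕ → ℕ
weight false s k = sumUpTo s k
weight true  s k = sumUpTo s k + nzUpTo s k

cost : Bool → ℕ → ℕ
cost false x = x
cost true zero = zero
cost true (suc x) = suc (suc x)

Cmp : Bool → Seq → Seq → Set
Cmp nz s t = ∃ λ k → (∀ i → i < k → s i ≡ t i) × cmpAt (weight nz s k) (s k) (t k)

weight-start : ∀ nz s → weight nz s 0 ≡ 0
weight-start false s = refl
weight-start true s = refl

cost-zero : ∀ nz → cost nz 0 ≡ 0
cost-zero false = refl
cost-zero true = refl

weight-suc : ∀ nz s k → weight nz s (suc k) ≡ weight nz s k + cost nz (s k)
weight-suc false s k = refl
weight-suc true s k with s k
... | zero = zero-step (sumUpTo s k) (nzUpTo s k)
  where
  zero-step : ∀ m n → m + 0 + n ≡ m + n + 0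
  zero-step = solve-∀
... | suc y = nonzero-step (sumUpTo s k) (nzUpTo s k) y
  where
  nonzero-step : ∀ m n y → m + suc y + suc n ≡ m + n + suc (suc y)
  nonzero-step = solve-∀

weight-agree : ∀ nz {s t} k → (∀ i → i < k → s i ≡ t i) → weight nz s k ≡ weight nz t k
weight-agree nz {s} {t} zero _ = trans (weight-start nz s) (sym (weight-start nz t))
weight-agree nz {s} {t} (suc k) agree = begin
  weight nz s (suc k)          ≡⟨ weight-suc nz s k ⟩
  weight nz s k + cost nz (s k) ≡⟨ cong₂ (λ w x → w + cost nz x)
                                      (weight-agree nz k (λ i i<k → agree i (m<n⇒m<1+n i<k)))
                                      (agree k (n<1+n k)) ⟩
  weight nz t k + cost nz (t k) ≡⟨ sym (weight-suc nz t k) ⟩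
  weight nz t (suc k)          ∎
  where open ≡-Reasoning

weight-zeros : ∀ nz k → weight nz zeros k ≡ 0
weight-zeros nz zero = weight-start nz zeros
weight-zeros nz (suc k) = trans (weight-suc nz zeros k) (cong₂ _+_ (weight-zeros nz k) (cost-zero nz))

weight-cons : ∀ nz s k → weight nz s (suc k) ≡ cost nz (s 0) + weight nz (λ i → s (suc i)) k
weight-cons nz s zero = begin
  weight nz s 1                 ≡⟨ weight-suc nz s 0 ⟩
  weight nz s 0 + cost nz (s 0) ≡⟨ cong (_+ cost nz (s 0)) (weight-start nz s) ⟩
  cost nz (s 0)                 ≡⟨ sym (+-identityʳ _) ⟩
  cost nz (s 0) + 0             ≡⟨ cong (cost nz (s 0) +_) (sym (weight-start nz _)) ⟩
  cost nz (s 0) + weight nz (λ i → s (suc i)) 0 ∎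
  where open ≡-Reasoning
weight-cons nz s (suc k) = begin
  weight nz s (suc (suc k))                        ≡⟨ weight-suc nz s (suc k) ⟩
  weight nz s (suc k) + cost nz (s (suc k))        ≡⟨ cong (_+ cost nz (s (suc k))) (weight-cons nz s k) ⟩
  cost nz (s 0) + weight nz s′ k + cost nz (s′ k)  ≡⟨ +-assoc (cost nz (s 0)) _ _ ⟩
  cost nz (s 0) + (weight nz s′ k + cost nz (s′ k)) ≡⟨ cong (cost nz (s 0) +_) (sym (weight-suc nz s′ k)) ⟩
  cost nz (s 0) + weight nz s′ (suc k)             ∎
  where
  open ≡-Reasoning
  s′ : Seq
  s′ i = s (suc i)

weight-⊙ : ∀ nz u s j → weight nz (u ⊙ s) (length u + j) ≡ weight nz (u ⊙ zeros) (length u) + weight nz s j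
weight-⊙ nz [] s j = cong (_+ weight nz s j) (sym (weight-start nz zeros))
weight-⊙ nz (x ∷ u) s j = begin
  weight nz ((x ∷ u) ⊙ s) (suc (length u + j))
    ≡⟨ weight-cons nz ((x ∷ u) ⊙ s) (length u + j) ⟩
  cost nz x + weight nz (u ⊙ s) (length u + j)
    ≡⟨ cong (cost nz x +_) (weight-⊙ nz u s j) ⟩
  cost nz x + (weight nz (u ⊙ zeros) (length u) + weight nz s j)
    ≡⟨ sym (+-assoc (cost nz x) _ _) ⟩
  cost nz x + weight nz (u ⊙ zeros) (length u) + weight nz s j
    ≡⟨ cong (_+ weight nz s j) (sym (weight-cons nz ((x ∷ u) ⊙ zeros) (length u))) ⟩
  weight nz ((x ∷ u) ⊙ zeros) (suc (length u)) + weight nz s j ∎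
  where open ≡-Reasoning

parity-weight-cons : ∀ nz s k →
  parity (weight nz s (suc k)) ≡ parity (cost nz (s 0)) ⊕ parity (weight nz (λ i → s (suc i)) k)
parity-weight-cons nz s k = trans (cong parity (weight-cons nz s k)) (Parityₚ.+-homo-+ (cost nz (s 0)) _)

parity-weight-⊙ : ∀ nz u s j →
  parity (weight nz (u ⊙ s) (length u + j)) ≡ parity (weight nz (u ⊙ zeros) (length u)) ⊕ parity (weight nz s j)
parity-weight-⊙ nz u s j = trans (cong parity (weight-⊙ nz u s j)) (Parityₚ.+-homo-+ (weight nz (u ⊙ zeros) (length u)) _)

parity-start : ∀ nz s → parity (weight nz s 0) ≡ 0ℙ
parity-start nz s = cong parity (weight-start nz s)

parity-zeros : ∀ nz j → parity (weight nz zeros j) ≡ 0ℙ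
parity-zeros nz j = cong parity (weight-zeros nz j)

Precedes : Parity → ℕ → ℕ → Set
Precedes e x y = (e ≡ 0ℙ × x < y) ⊎ (e ≡ 1ℙ × y < x)

precedes-0 : ∀ {x y} → Precedes 0ℙ x y → x < y
precedes-0 (inj₁ (_ , x<y)) = x<y
precedes-0 (inj₂ (() , _))

precedes-1 : ∀ {x y} → Precedes 1ℙ x y → y < x
precedes-1 (inj₁ (() , _))
precedes-1 (inj₂ (_ , y<x)) = y<x

precedes-irrefl : ∀ {e x} → ¬ Precedes e x x
precedes-irrefl (inj₁ (_ , x<x)) = <-irrefl refl x<x
precedes-irrefl (inj₂ (_ , x<x)) = <-irrefl refl x<x

precedes-at : ∀ {e e′ x y} → e ≡ e′ → Precedes e x y → Precedes e′ x y
precedes-at refl prec = prec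

precedes-swap : ∀ {e x y} → Precedes e y x → Precedes (e ⁻¹) x y
precedes-swap (inj₁ (refl , y<x)) = inj₂ (refl , y<x)
precedes-swap (inj₂ (refl , x<y)) = inj₁ (refl , x<y)

cmpAt⇒precedes : ∀ n {x y} → cmpAt n x y → Precedes (parity n) x y
cmpAt⇒precedes n (inj₁ (n-even , x<y)) = inj₁ (even⇒parity n n-even , x<y)
cmpAt⇒precedes n (inj₂ (n-odd , y<x)) = inj₂ (odd⇒parity n n-odd , y<x)

-- Read alone, position k would put a before b (δ = 0ℙ) or after b (δ = 1ℙ);
-- the comparison uses the weight of b.
Beats : Bool → Parity → Seq → Seq → ℕ → Set
Beats nz δ a b k = Precedes (δ ⊕ parity (weight nz b k)) (a k) (b k)

-- A first (δ = 0ℙ) or last (δ = 1ℙ) word a of S coincides with every b ∈ S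
-- that it beats at no position: otherwise the first difference is such a
-- position.
extremal-unique : ∀ {q nz S a} → (∀ {s t} → Appr q s t → Cmp nz s t) →
  IsFirst q S a ⊎ IsLast q S a →
  ∃ λ δ → ∀ b → S b → (∀ k → ¬ Beats nz δ a b k) → a ≐ b
extremal-unique {nz = nz} {S} {a} appr⇒cmp (inj₁ (_ , first)) = 0ℙ , unique
  where
  unique : ∀ b → S b → (∀ k → ¬ Beats nz 0ℙ a b k) → a ≐ b
  unique b b∈S unbeaten with first b b∈S
  ... | inj₁ b≐a = λ i → sym (b≐a i)
  ... | inj₂ a<b with appr⇒cmp a<b
  ...   | k , agree , cmp =
    ⊥-elim (unbeaten k (subst (λ w → Precedes (parity w) (a k) (b k)) (weight-agree nz k agree)
                                (cmpAt⇒precedes (weight nz a k) cmp)))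
extremal-unique {nz = nz} {S} {a} appr⇒cmp (inj₂ (_ , last)) = 1ℙ , unique
  where
  unique : ∀ b → S b → (∀ k → ¬ Beats nz 1ℙ a b k) → a ≐ b
  unique b b∈S unbeaten with last b b∈S
  ... | inj₁ b≐a = λ i → sym (b≐a i)
  ... | inj₂ b<a with appr⇒cmp b<a
  ...   | k , _ , cmp = ⊥-elim (unbeaten k (precedes-swap (cmpAt⇒precedes (weight nz b k) cmp)))

at-++ˡ : ∀ u v j → j < length u → at (u ++ v) j ≡ at u j
at-++ˡ (x ∷ u) v zero _ = refl
at-++ˡ (x ∷ u) v (suc j) (s≤s j<u) = at-++ˡ u v j j<u

at-∷ʳ : ∀ u x → at (u ∷ʳ x) (length u) ≡ x
at-∷ʳ [] x = refl
at-∷ʳ (y ∷ u) x = at-∷ʳ u x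

length-∷ʳ : ∀ (u : List ℕ) x → length (u ∷ʳ x) ≡ suc (length u)
length-∷ʳ u x = trans (length-++ u) (+-comm (length u) 1)

index-∷ʳ⁺ : ∀ (u : List ℕ) x {j} → j ≤ length u → j < length (u ∷ʳ x)
index-∷ʳ⁺ u x {j} j≤u = subst (j <_) (sym (length-∷ʳ u x)) (s≤s j≤u)

index-∷ʳ⁻ : ∀ (u : List ℕ) x {j} → j < length (u ∷ʳ x) → j ≤ length u
index-∷ʳ⁻ u x {j} j<ux = ≤-pred (subst (j <_) (length-∷ʳ u x) j<ux)

prefix-⊙ : ∀ u s → PrefixOf u (u ⊙ s)
prefix-⊙ (x ∷ u) s zero _ = refl
prefix-⊙ (x ∷ u) s (suc j) (s≤s j<u) = prefix-⊙ u s j j<u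

⊙-shift : ∀ u s j → (u ⊙ s) (length u + j) ≡ s j
⊙-shift [] s j = refl
⊙-shift (x ∷ u) s j = ⊙-shift u s j

⊙-++ : ∀ u v s → (u ++ v) ⊙ s ≐ u ⊙ (v ⊙ s)
⊙-++ [] v s i = refl
⊙-++ (x ∷ u) v s zero = refl
⊙-++ (x ∷ u) v s (suc i) = ⊙-++ u v s i

⊙-word : ∀ {q u s} → Word q u → InfWord q s → InfWord q (u ⊙ s)
⊙-word [] s-word i = s-word i
⊙-word (x<q ∷ _) s-word zero = x<q
⊙-word (_ ∷ u-word) s-word (suc i) = ⊙-word u-word s-word i

OccursAt : List ℕ → Seq → ℕ → Set
OccursAt g s i = ∀ j → j < length g → s (i + j) ≡ at g j

occurs-∷ʳ⁻ : ∀ g x s i → OccursAt (g ∷ʳ x) s i → OccursAt g s i × s (i + length g) ≡ x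
occurs-∷ʳ⁻ g x s i occ =
  (λ j j<g → trans (occ j (index-∷ʳ⁺ g x (<⇒≤ j<g))) (at-++ˡ g (x ∷ []) j j<g)) ,
  trans (occ (length g) (index-∷ʳ⁺ g x ≤-refl)) (at-∷ʳ g x)

occurs-∷ʳ⁺ : ∀ g x s i → OccursAt g s i → s (i + length g) ≡ x → OccursAt (g ∷ʳ x) s i
occurs-∷ʳ⁺ g x s i occ last j j<gx with m≤n⇒m<n∨m≡n (index-∷ʳ⁻ g x j<gx)
... | inj₁ j<g = trans (occ j j<g) (sym (at-++ˡ g (x ∷ []) j j<g))
... | inj₂ refl = trans last (sym (at-∷ʳ g x))

occurs-transfer : ∀ p s s′ g i → i + length g ≤ length p → PrefixOf p s → PrefixOf p s′ →
  OccursAt g s i → OccursAt g s′ i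
occurs-transfer p s s′ g i fits s-p s′-p occ j j<g =
  trans (s′-p (i + j) covered) (trans (sym (s-p (i + j) covered)) (occ j j<g))
  where
  covered : i + j < length p
  covered = <-≤-trans (+-monoʳ-< i j<g) fits

occurs-at-start : ∀ f p s → length f ≤ length p → OccursAt f (p ⊙ s) 0 → ∃ λ v → p ≡ f ++ v
occurs-at-start [] p s _ _ = p , refl
occurs-at-start (y ∷ f) (z ∷ p) s (s≤s fits) occ with occurs-at-start f p s fits (λ j j<f → occ (suc j) (s≤s j<f))
... | v , p≡fv = v , cong₂ _∷_ (occ 0 z<s) p≡fv

occurs⇒factor : ∀ f p s i → i + length f ≤ length p → OccursAt f (p ⊙ s) i → FactorFin f p
occurs⇒factor f p s zero fits occ with occurs-at-start f p s fits occ
... | v , p≡fv = [] , v , p≡fv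
occurs⇒factor f (z ∷ p) s (suc i) (s≤s fits) occ with occurs⇒factor f p s i fits occ
... | u , v , p≡ufv = z ∷ u , v , cong (z ∷_) p≡ufv

constant-run : ∀ (h : ℕ → ℕ) L → (∀ j → j < L → h j ≡ h (suc j)) → ∀ j → j ≤ L → h j ≡ h L
constant-run h zero _ zero z≤n = refl
constant-run h (suc L) step j j≤1+L with m≤n⇒m<n∨m≡n j≤1+L
... | inj₁ j<1+L = trans (constant-run h L (λ i i<L → step i (m<n⇒m<1+n i<L)) j (≤-pred j<1+L))
                         (step L (n<1+n L))
... | inj₂ refl = refl

all-equal⇒replicate : ∀ g v → (∀ j → j < length g → at g j ≡ v) → g ≡ replicate (length g) v
all-equal⇒replicate [] v _ = refl
all-equal⇒replicate (y ∷ g) v equal =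
  cong₂ _∷_ (equal 0 z<s) (all-equal⇒replicate g v (λ j j<g → equal (suc j) (s≤s j<g)))

self-overlap : ∀ g s i → OccursAt g s i → OccursAt g s (suc i) → g ≡ replicate (length g) (s (i + length g))
self-overlap g s i occ occ′ = all-equal⇒replicate g _ λ j j<g →
  trans (sym (occ j j<g)) (constant-run (λ j → s (i + j)) (length g) shift j (<⇒≤ j<g))
  where
  shift : ∀ j → j < length g → s (i + j) ≡ s (i + suc j)
  shift j j<g = trans (occ j j<g) (trans (sym (occ′ j j<g)) (cong s (sym (+-suc i j))))

-- For q ≥ 3 the appropriate order is Cmp nz for an nz in which the symbol
-- q-1 has odd cost and q-2 has even cost: for even q the order ≺ (cost x),
-- for odd q the order ◁ (cost x+1 on nonzero x).
record AppropriateWeight (q : ℕ) : Set where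
  field
    nz : Bool
    appr⇒cmp : ∀ {s t} → Appr q s t → Cmp nz s t
    cost-top : parity (cost nz (q ∸ 1)) ≡ 1ℙ
    cost-next : parity (cost nz (q ∸ 2)) ≡ 0ℙ

appropriateWeight : ∀ Q → AppropriateWeight (3 + Q)
appropriateWeight Q with parity (suc Q) in q-parity
... | 0ℙ = record
  { nz = false
  ; appr⇒cmp = λ { (inj₁ (_ , s≺t)) → s≺t
                 ; (inj₂ (q-odd , _)) → contradiction (trans (sym q-parity) (odd⇒parity (3 + Q) q-odd)) λ () }
  ; cost-top = trans (sym (Parityₚ.suc-homo-⁻¹ Q)) (cong _⁻¹ q-parity)
  ; cost-next = q-parity
  }
... | 1ℙ = record
  { nz = true
  ; appr⇒cmp = λ { (inj₁ (q-even , _)) → contradiction (trans (sym (even⇒parity (3 + Q) q-even)) q-parity) λ ()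
                 ; (inj₂ (_ , s◁t)) → s◁t }
  ; cost-top = q-parity
  ; cost-next = trans (sym (Parityₚ.suc-homo-⁻¹ Q)) (cong _⁻¹ q-parity)
  }

module Candidates (Q : ℕ) (A : AppropriateWeight (3 + Q)) (g p : List ℕ)
  (p-word : Word (3 + Q) p) (p-avoids : ¬ FactorFin (g ∷ʳ suc (suc Q)) p)
  (f∉W : ¬ InW (3 + Q) (g ∷ʳ suc (suc Q))) where

  open AppropriateWeight A

  q top next n : ℕ
  q = 3 + Q
  top = suc (suc Q)
  next = suc Q
  n = length p

  f : List ℕ
  f = g ∷ʳ top

  S : Seq → Set
  S = InSet q f p

  top-maximal : ∀ {x} → x < q → ¬ top < x
  top-maximal x<q top<x = <⇒≱ top<x (≤-pred x<q)

  prefixParity : Parity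
  prefixParity = parity (weight nz (p ⊙ zeros) n)

  TailSafe : Parity → Seq → Seq → Set
  TailSafe σ a t = ∀ j → ¬ Precedes (σ ⊕ parity (weight nz t j)) (a (n + j)) (t j)

  -- Before position n the candidate agrees with a; from n on the comparison
  -- is the one of the tails, with orientation shifted by prefixParity.
  unbeaten : ∀ {a δ} t → PrefixOf p a → TailSafe (δ ⊕ prefixParity) a t → ∀ k → ¬ Beats nz δ a (p ⊙ t) k
  unbeaten {a} {δ} t a-p safe k beats with k <? n
  ... | yes k<n =
    precedes-irrefl (subst (Precedes _ (a k)) (trans (prefix-⊙ p t k k<n) (sym (a-p k k<n))) beats)
  ... | no k≮n with m≤n⇒∃[o]m+o≡n (≮⇒≥ k≮n)
  ...   | j , refl = safe j (subst₂ (λ e y → Precedes e (a (n + j)) y) orientation (⊙-shift p t j) beats)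
    where
    orientation : δ ⊕ parity (weight nz (p ⊙ t) (n + j)) ≡ (δ ⊕ prefixParity) ⊕ parity (weight nz t j)
    orientation = trans (cong (δ ⊕_) (parity-weight-⊙ nz p t j)) (sym (Parityₚ.+-assoc δ prefixParity _))

  oneTail twoTail : Seq
  oneTail = (top ∷ []) ⊙ zeros
  twoTail = (next ∷ top ∷ []) ⊙ zeros

  parity-oneTail : ∀ j → parity (weight nz oneTail (suc j)) ≡ 1ℙ
  parity-oneTail j = trans (parity-weight-cons nz oneTail j) (cong₂ _⊕_ cost-top (parity-zeros nz j))

  parity-twoTail₁ : parity (weight nz twoTail 1) ≡ 0ℙ
  parity-twoTail₁ = trans (parity-weight-cons nz twoTail 0) (cong₂ _⊕_ cost-next (parity-start nz oneTail))

  parity-twoTail : ∀ j → parity (weight nz twoTail (suc (suc j))) ≡ 1ℙ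
  parity-twoTail j = trans (parity-weight-cons nz twoTail (suc j)) (cong₂ _⊕_ cost-next (parity-oneTail j))

  -- Where the orientation favours small symbols, 0^∞ cannot be beaten.
  zeros-safe : ∀ a → TailSafe 0ℙ a zeros
  zeros-safe a j prec = n≮0 (precedes-0 (precedes-at (parity-zeros nz j) prec))

  -- Otherwise (q-1) cannot be beaten, and neither can the zeros after it,
  -- since the odd cost of q-1 turns the orientation around.
  oneTail-safe : ∀ a → InfWord q a → TailSafe 1ℙ a oneTail
  oneTail-safe a a-word zero prec =
    top-maximal (a-word (n + 0)) (precedes-1 (precedes-at (cong (1ℙ ⊕_) (parity-start nz oneTail)) prec))
  oneTail-safe a a-word (suc j) prec =
    n≮0 (precedes-0 (precedes-at (cong (1ℙ ⊕_) (parity-oneTail j)) prec))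

  -- The tail (q-2)(q-1)0^∞ can only be beaten by a word having q-1 at n;
  -- the even cost of q-2 keeps the orientation for the following q-1.
  twoTail-safe : ∀ a → InfWord q a → a n ≢ top → TailSafe 1ℙ a twoTail
  twoTail-safe a a-word a-n≢top zero prec = a-n≢top (≤-antisym (≤-pred (a-word n)) next<a-n)
    where
    next<a-n : next < a n
    next<a-n = subst (next <_) (cong a (+-identityʳ n))
                 (precedes-1 (precedes-at (cong (1ℙ ⊕_) (parity-start nz twoTail)) prec))
  twoTail-safe a a-word _ (suc zero) prec =
    top-maximal (a-word (n + 1)) (precedes-1 (precedes-at (cong (1ℙ ⊕_) parity-twoTail₁) prec))
  twoTail-safe a a-word _ (suc (suc j)) prec =
    n≮0 (precedes-0 (precedes-at (cong (1ℙ ⊕_) (parity-twoTail j)) prec))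

  -- g is a suffix of p: the only way p (q-1) can contain f.
  SuffixG : Set
  SuffixG = ∃ λ i → i + length g ≡ n × OccursAt g (p ⊙ zeros) i

  suffixG? : Dec SuffixG
  suffixG? with length g ≤? n
  ... | no g-long = no λ (i , ends , _) → g-long (subst (length g ≤_) ends (m≤n+m (length g) i))
  ... | yes g-short with allUpTo? (λ j → (p ⊙ zeros) (n ∸ length g + j) ≟ at g j) (length g)
  ...   | yes occ = yes (n ∸ length g , m∸n+n≡m g-short , λ j j<g → occ j<g)
  ...   | no ¬occ = no λ (i , ends , occ) → ¬occ λ {j} j<g → subst (OccursAt g (p ⊙ zeros)) (start ends) occ j j<g
    where
    start : ∀ {i} → i + length g ≡ n → i ≡ n ∸ length g
    start {i} ends = trans (sym (m+n∸n≡m i (length g))) (cong (_∸ length g) ends)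

  -- Since p avoids f and f ends with q-1, an occurrence of f in p t must end
  -- inside t at a symbol q-1.
  occurrence-in-tail : ∀ t i → OccursAt f (p ⊙ t) i → ∃ λ j → i + length g ≡ n + j × t j ≡ top
  occurrence-in-tail t i occ with i + length g <? n
  ... | yes inside = contradiction (occurs⇒factor f p t i fits occ) p-avoids
    where
    fits : i + length f ≤ n
    fits = subst (λ m → i + m ≤ n) (sym (length-∷ʳ g top)) (subst (_≤ n) (sym (+-suc i (length g))) inside)
  ... | no outside with m≤n⇒∃[o]m+o≡n (≮⇒≥ outside)
  ...   | j , ends =
    j , sym ends , trans (sym (⊙-shift p t j)) (trans (cong (p ⊙ t) ends) (proj₂ (occurs-∷ʳ⁻ g top (p ⊙ t) i occ)))

  zeros-avoids : ¬ FactorInf f (p ⊙ zeros)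
  zeros-avoids (i , occ) with occurrence-in-tail zeros i occ
  ... | _ , _ , ()

  oneTail-avoids : ¬ SuffixG → ¬ FactorInf f (p ⊙ oneTail)
  oneTail-avoids no-suffix (i , occ) with occurrence-in-tail oneTail i occ
  ... | suc _ , _ , ()
  ... | zero , ends , _ =
    no-suffix (i , ends′ , occurs-transfer p (p ⊙ oneTail) (p ⊙ zeros) g i (≤-reflexive ends′)
                             (prefix-⊙ p oneTail) (prefix-⊙ p zeros) (proj₁ (occurs-∷ʳ⁻ g top (p ⊙ oneTail) i occ)))
    where
    ends′ : i + length g ≡ n
    ends′ = trans ends (+-identityʳ n)

  -- An occurrence of f in p (q-2)(q-1)0^∞ would overlap the suffix g of p by
  -- one place, making g constant = (q-2)^ℓ and f ∈ W_q.
  twoTail-avoids : SuffixG → ¬ FactorInf f (p ⊙ twoTail)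
  twoTail-avoids (i₀ , ends₀ , occ₀) (i , occ) with occurrence-in-tail twoTail i occ
  ... | zero , _ , next≡top = 1+n≢n (sym next≡top)
  ... | suc (suc _) , _ , ()
  ... | suc zero , ends , _ = f∉W (length g , cong (_∷ʳ top) g-constant)
    where
    b : Seq
    b = p ⊙ twoTail
    i≡ : i ≡ suc i₀
    i≡ = +-cancelʳ-≡ (length g) i (suc i₀) (trans ends (trans (+-comm n 1) (cong suc (sym ends₀))))
    g-at-i₀ : OccursAt g b i₀
    g-at-i₀ = occurs-transfer p (p ⊙ zeros) b g i₀ (≤-reflexive ends₀) (prefix-⊙ p zeros) (prefix-⊙ p twoTail) occ₀
    g-at-1+i₀ : OccursAt g b (suc i₀)
    g-at-1+i₀ = subst (OccursAt g b) i≡ (proj₁ (occurs-∷ʳ⁻ g top b i occ))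
    b-at-end : b (i₀ + length g) ≡ next
    b-at-end = trans (cong b (trans ends₀ (sym (+-identityʳ n)))) (⊙-shift p twoTail 0)
    g-constant : g ≡ replicate (length g) next
    g-constant = trans (self-overlap g b i₀ g-at-i₀ g-at-1+i₀) (cong (replicate (length g)) b-at-end)

  suffix-blocks-top : SuffixG → ∀ {a} → S a → a n ≢ top
  suffix-blocks-top (i₀ , ends₀ , occ₀) {a} (_ , a-avoids , a-p) a-n≡top =
    a-avoids (i₀ , occurs-∷ʳ⁺ g top a i₀ g-at-i₀ (trans (cong a ends₀) a-n≡top))
    where
    g-at-i₀ : OccursAt g a i₀
    g-at-i₀ = occurs-transfer p (p ⊙ zeros) a g i₀ (≤-reflexive ends₀) (prefix-⊙ p zeros) a-p occ₀

  candidate-member : ∀ r → Word q r → ¬ FactorInf f (p ⊙ (r ⊙ zeros)) → S (p ⊙ (r ⊙ zeros))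
  candidate-member r r-word avoids = ⊙-word p-word (⊙-word r-word (λ _ → z<s)) , avoids , prefix-⊙ p _

  top<q : top < q
  top<q = n<1+n top

  next<q : next < q
  next<q = m<n⇒m<1+n (n<1+n next)

  settle : ∀ {a} δ r → (∀ b → S b → (∀ k → ¬ Beats nz δ a b k) → a ≐ b) → S (p ⊙ (r ⊙ zeros)) →
    PrefixOf p a → TailSafe (δ ⊕ prefixParity) a (r ⊙ zeros) → a ≐ (p ++ r) ⊙ zeros
  settle δ r unique member a-p safe i =
    trans (unique _ member (unbeaten {δ = δ} (r ⊙ zeros) a-p safe) i) (sym (⊙-++ p r zeros i))

  classify : ∀ a → IsFirst q S a ⊎ IsLast q S a →
    ∃ λ r → (r ≡ [] ⊎ r ≡ top ∷ [] ⊎ r ≡ next ∷ top ∷ []) × a ≐ (p ++ r) ⊙ zeros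
  classify a extremal with extremal-unique {q = q} {nz = nz} appr⇒cmp extremal | [ proj₁ , proj₁ ]′ extremal
  ... | δ , unique | a∈S@(a-word , _ , a-p) with δ ⊕ prefixParity in orientation | suffixG?
  ... | 0ℙ | _ = [] , inj₁ refl ,
    settle δ [] unique (candidate-member [] [] zeros-avoids) a-p
           (subst (λ σ → TailSafe σ a zeros) (sym orientation) (zeros-safe a))
  ... | 1ℙ | no no-suffix = top ∷ [] , inj₂ (inj₁ refl) ,
    settle δ (top ∷ []) unique (candidate-member (top ∷ []) (top<q ∷ []) (oneTail-avoids no-suffix)) a-p
           (subst (λ σ → TailSafe σ a oneTail) (sym orientation) (oneTail-safe a a-word))
  ... | 1ℙ | yes suffix = next ∷ top ∷ [] , inj₂ (inj₂ refl) ,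
    settle δ (next ∷ top ∷ []) unique
           (candidate-member (next ∷ top ∷ []) (next<q ∷ top<q ∷ []) (twoTail-avoids suffix)) a-p
           (subst (λ σ → TailSafe σ a twoTail) (sym orientation)
                  (twoTail-safe a a-word (suffix-blocks-top suffix a∈S)))

proposition9 : (q : ℕ) → 3 ≤ q →
    (f : List ℕ) → Word q f → ¬ InW q f → (∃ λ g → f ≡ g ∷ʳ (q ∸ 1)) →
    (p : List ℕ) → Word q p → ¬ FactorFin f p →
    (a : Seq) → (IsFirst q (InSet q f p) a ⊎ IsLast q (InSet q f p) a) →
    ∃ λ r → (r ≡ [] ⊎ r ≡ (q ∸ 1) ∷ [] ⊎ r ≡ (q ∸ 2) ∷ (q ∸ 1) ∷ []) ×
      a ≐ (p ++ r) ⊙ zeros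
proposition9 (suc (suc (suc Q))) (s≤s (s≤s (s≤s _))) _ _ f∉W (g , refl) p p-word p-avoids =
  Candidates.classify Q (appropriateWeight Q) g p p-word p-avoids f∉W
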